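{- Let $n\ge 7$ be an odd integer not divisible by $3$. For $a\in\mathbb Z_n$ let $B_a$ be the collection of blocks $\{a-i,a+i\}\cup\{a-j,a+j\}$ (computed mod $n$) for $1\le i<j\le\frac{n-1}{2}$, i.e. all unions of two distinct pairs $\{a-i,a+i\}$. Then $(\mathbb Z_n,\bigcup_{a\in\mathbb Z_n}B_a)$ is a $3$-$(n,4,2)$ adesign.
   Context: A $t$-$(v,k,\lambda)$ adesign is an incidence structure with $v$ points and blocks of size $k$ such that every $t$-subset of points lies in exactly $\lambda$ or exactly $\lambda+1$ blocks, both values occurring. -}

module Defs where

open import Data.Nat using (ℕ; zero; suc; _+_; _∸_; _<ᵇ_; NonZero; _/_)
open import Data.Nat.DivMod using (_mod_)
open import Data.Fin using (Fin; toℕ)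
open import Data.Fin.Subset using (Subset; ⁅_⁆; _∪_; ∣_∣; _⊆_)
open import Data.Fin.Subset.Properties using (_⊆?_)
open import Data.List using (List; []; _∷_; length; filter; concatMap; upTo; map; allFin)
open import Data.List.Relation.Unary.All using (All)
open import Data.Product using (_×_; Σ)
open import Data.Sum using (_⊎_)
open import Data.Bool using (if_then_else_)
open import Relation.Binary.PropositionalEquality using (_≡_)

-- An incidence structure on the point set Fin v is given by a list
-- (i.e. a multiset) of blocks, each block a subset of the points.

occurrences : {v : ℕ} → Subset v → List (Subset v) → ℕ
occurrences T B = length (filter (T ⊆?_) B)

IsAdesign : (t v k lam : ℕ) → List (Subset v) → Set
IsAdesign t v k lam B =
  All (λ b → ∣ b ∣ ≡ k) B
  × ((T : Subset v) → ∣ T ∣ ≡ t →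
       (occurrences T B ≡ lam) ⊎ (occurrences T B ≡ suc lam))
  × Σ (Subset v) (λ T → ∣ T ∣ ≡ t × occurrences T B ≡ lam)
  × Σ (Subset v) (λ T → ∣ T ∣ ≡ t × occurrences T B ≡ suc lam)

plusMod : (n : ℕ) .{{_ : NonZero n}} → Fin n → ℕ → Fin n
plusMod n a i = (toℕ a + i) mod n

minusMod : (n : ℕ) .{{_ : NonZero n}} → Fin n → ℕ → Fin n
minusMod n a i = (toℕ a + (n ∸ toℕ (i mod n))) mod n

block : (n : ℕ) .{{_ : NonZero n}} → Fin n → ℕ → ℕ → Subset n
block n a i j =
  ⁅ minusMod n a i ⁆ ∪ ⁅ plusMod n a i ⁆ ∪ ⁅ minusMod n a j ⁆ ∪ ⁅ plusMod n a j ⁆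

indices : ℕ → List ℕ
indices n = map suc (upTo ((n ∸ 1) / 2))

Ba : (n : ℕ) .{{_ : NonZero n}} → Fin n → List (Subset n)
Ba n a = concatMap (λ i → concatMap (λ j →
           if i <ᵇ j then block n a i j ∷ [] else []) (indices n)) (indices n)

allBlocks : (n : ℕ) .{{_ : NonZero n}} → List (Subset n)
allBlocks n = concatMap (Ba n) (allFin n)

module Submission where

-- Write n = 2m + 1.  The points at cyclic distance i ∈ [1, m] from a are a ± i, so the blocks of
-- B_a are the sets {p ∣ dist a p ∈ {i, j}} with 1 ≤ i < j ≤ m.  A triple {x, y, z} lies in such a
-- block only if two of its points are equidistant from a, i.e. a is their midpoint (2a ≡ x + y,
-- unique because n is odd), and then it lies in exactly one block of B_a unless the third point
-- is a itself.  Summing over a, the triple lies in 3 − k blocks, where k is the number of its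
-- points that are the midpoint of the other two.  Two such points would force 3y ≡ 3z, so
-- k ≤ 1 when 3 ∤ n; the triples {0, 1, 2} (k = 1) and {0, 1, 3} (k = 0) show both values occur.

open import Defs

open import Data.Bool.Base using (true; false; if_then_else_; T)
open import Data.Empty using (⊥-elim)
open import Data.Fin using (Fin; zero; suc; toℕ; #_)
import Data.Fin.Properties as Fin
open import Data.Fin.Properties using (toℕ<n; toℕ-injective; toℕ-fromℕ<) renaming (_≟_ to _≟ᶠ_)
open import Data.Fin.Subset using (Subset; inside; outside; ⊥; ⁅_⁆; _∪_; ⋃; ∣_∣; _∈_; _∉_; _⊆_)
open import Data.Fin.Subset.Properties
  using (_⊆?_; x≢y⇒x∉⁅y⁆; x∈⁅x⁆; x∈⁅y⁆⇒x≡y; x∈p∪q⁻; x∈p∪q⁺; ∣⁅x⁆∣≡1;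
         ∪-comm; ∪-assoc; ∪-identityˡ; ∪-identityʳ)
open import Data.List.Base using (List; []; _∷_; _++_; length; filter; concatMap; map; allFin)
open import Data.List.Membership.Propositional using () renaming (_∈_ to _∈ₗ_)
open import Data.List.Membership.Propositional.Properties using (∈-map⁺; ∈-map⁻; ∈-upTo⁺; ∈-upTo⁻; ∈-allFin)
open import Data.List.Properties using (length-map; filter-++; length-++; filter-accept; filter-reject; map-cong)
open import Data.List.Relation.Unary.All as All using (All; []; _∷_)
import Data.List.Relation.Unary.All.Properties as AllP
open import Data.List.Relation.Unary.Any using (here; there)
open import Data.List.Relation.Unary.Unique.Propositional using (Unique; []; _∷_)
import Data.List.Relation.Unary.Unique.Propositional.Properties as Unique
open import Data.Nat.Base
open import Data.Nat.Coprimality using (Coprime; coprime-divisor)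
open import Data.Nat.Divisibility using (_∣_; _∤_; m%n≡0⇒n∣m; _∣0; ∣-refl; ∣m∣n⇒∣m+n)
import Data.Nat.DivMod as DivMod
open import Data.Nat.DivMod
  using (_%_; _/_; m*n/n≡m; m%n<n; m%n%n≡m%n; n%n≡0; %-distribˡ-+; %-distribˡ-*; [m+n]%n≡m%n; [m+kn]%n≡m%n;
         m<n⇒m%n≡m; m%n≤n; %-remove-+ʳ)
open import Data.Nat.ListAction using (sum)
open import Data.Nat.Primality using (Prime; prime?; prime⇒irreducible)
open import Data.Nat.Properties
open import Algebra.Properties.CommutativeSemigroup +-commutativeSemigroup using (interchange; x∙yz≈y∙xz; xy∙z≈xz∙y)
open import Data.Nat.Tactic.RingSolver using (solve-∀)
open import Data.Product using (∃-syntax; _×_; _,_; proj₁; proj₂; swap)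
import Data.Product as Product
open import Data.Sum using (_⊎_; inj₁; inj₂; [_,_]′)
import Data.Sum as Sum
import Data.Vec.Base as Vec
open import Function.Base using (_∘_)
open import Function.Bundles using (_⇔_; mk⇔; Equivalence)
open import Level using (Level; 0ℓ)
open import Relation.Binary.Bundles using (Setoid)
open import Relation.Binary.Definitions using (tri<; tri≈; tri>)
open import Relation.Binary.PropositionalEquality
import Relation.Binary.Reasoning.Setoid as SetoidReasoning
open import Relation.Binary.Structures using (IsEquivalence)
open import Relation.Nullary using (¬_; Dec; yes; no; does; contradiction)
open import Relation.Nullary.Decidable using (dec-true; dec-false; ¬?; _×-dec_; from-yes)
open import Relation.Unary using (Pred; Decidable)

private
  variable
    ℓ ℓ′ : Level
    A : Set ℓ
    B : Set ℓ′

module _ {P : Pred B ℓ} (P? : Decidable P) where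

  length-filter-concatMap : ∀ (f : A → List B) xs →
    length (filter P? (concatMap f xs)) ≡ sum (map (λ x → length (filter P? (f x))) xs)
  length-filter-concatMap f []       = refl
  length-filter-concatMap f (x ∷ xs) = begin
    length (filter P? (f x ++ concatMap f xs))
      ≡⟨ cong length (filter-++ P? (f x) (concatMap f xs)) ⟩
    length (filter P? (f x) ++ filter P? (concatMap f xs))
      ≡⟨ length-++ (filter P? (f x)) ⟩
    length (filter P? (f x)) + length (filter P? (concatMap f xs))
      ≡⟨ cong (length (filter P? (f x)) +_) (length-filter-concatMap f xs) ⟩
    length (filter P? (f x)) + sum (map (λ x → length (filter P? (f x))) xs) ∎
    where open ≡-Reasoning

sum-map-+ : ∀ (f g : A → ℕ) xs → sum (map (λ x → f x + g x) xs) ≡ sum (map f xs) + sum (map g xs)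
sum-map-+ f g []       = refl
sum-map-+ f g (x ∷ xs) = trans (cong (f x + g x +_) (sum-map-+ f g xs))
                               (interchange (f x) (g x) _ _)

sum-map-≡0 : ∀ (f : A → ℕ) {xs} → (∀ {x} → x ∈ₗ xs → f x ≡ 0) → sum (map f xs) ≡ 0
sum-map-≡0 f {[]}     f≡0 = refl
sum-map-≡0 f {x ∷ xs} f≡0 = cong₂ _+_ (f≡0 (here refl)) (sum-map-≡0 f (f≡0 ∘ there))

sum-map-single : ∀ (f : A → ℕ) {c xs} → Unique xs → c ∈ₗ xs →
                 (∀ {x} → x ∈ₗ xs → x ≢ c → f x ≡ 0) → sum (map f xs) ≡ f c
sum-map-single f (x∉xs ∷ _) (here refl) f≡0 =
  trans (cong (f _ +_) (sum-map-≡0 f (λ x∈xs → f≡0 (there x∈xs) (λ { refl → All.lookup x∉xs x∈xs refl }))))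
        (+-identityʳ _)
sum-map-single f {xs = _ ∷ xs} (x∉xs ∷ uniq) (there c∈xs) f≡0 =
  trans (cong (_+ sum (map f xs)) (f≡0 (here refl) (All.lookup x∉xs c∈xs)))
        (sum-map-single f uniq c∈xs (f≡0 ∘ there))

𝟙 : {P : Set ℓ} → Dec P → ℕ
𝟙 P? = if does P? then 1 else 0

𝟙-yes : {P : Set ℓ} (P? : Dec P) → P → 𝟙 P? ≡ 1
𝟙-yes P? x rewrite dec-true P? x = refl

𝟙-no : {P : Set ℓ} (P? : Dec P) → ¬ P → 𝟙 P? ≡ 0
𝟙-no P? ¬x rewrite dec-false P? ¬x = refl

𝟙-yes-×-dec : {P : Set ℓ} {Q : Set ℓ′} (P? : Dec P) → P → (Q? : Dec Q) → 𝟙 (P? ×-dec Q?) ≡ 𝟙 Q?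
𝟙-yes-×-dec (yes _) _ _ = refl
𝟙-yes-×-dec (no ¬p) p _ = contradiction p ¬p

Covers : ℕ → ℕ → ℕ → Set
Covers i j u = u ≡ i ⊎ u ≡ j

covers-two : ∀ {i j u w} → u ≢ w → Covers i j u → Covers i j w →
             (i ≡ u × j ≡ w) ⊎ (i ≡ w × j ≡ u)
covers-two u≢w (inj₁ refl) (inj₁ refl) = contradiction refl u≢w
covers-two u≢w (inj₂ refl) (inj₂ refl) = contradiction refl u≢w
covers-two _   (inj₁ refl) (inj₂ refl) = inj₁ (refl , refl)
covers-two _   (inj₂ refl) (inj₁ refl) = inj₂ (refl , refl)

¬covers-three : ∀ {i j u v w} → u ≢ v → u ≢ w → v ≢ w →
                ¬ (Covers i j u × Covers i j v × Covers i j w)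
¬covers-three u≢v _   _   (inj₁ refl , inj₁ refl , _)         = u≢v refl
¬covers-three u≢v _   _   (inj₂ refl , inj₂ refl , _)         = u≢v refl
¬covers-three _   u≢w _   (inj₁ refl , inj₂ refl , inj₁ refl) = u≢w refl
¬covers-three _   _   v≢w (inj₁ refl , inj₂ refl , inj₂ refl) = v≢w refl
¬covers-three _   _   v≢w (inj₂ refl , inj₁ refl , inj₁ refl) = v≢w refl
¬covers-three _   u≢w _   (inj₂ refl , inj₁ refl , inj₂ refl) = u≢w refl

module _ (I : List ℕ) (b : ℕ → ℕ → A) where

  -- Ba n a is pairs (indices n) (block n a) by definition.
  pairs : List A
  pairs = concatMap (λ i → concatMap (λ j → if i <ᵇ j then b i j ∷ [] else []) I) I

  All-pairs⁺ : ∀ {Q : Pred A ℓ′} → (∀ {i j} → i ∈ₗ I → j ∈ₗ I → i < j → Q (b i j)) → All Q pairs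
  All-pairs⁺ {Q = Q} h = AllP.concat⁺ (AllP.map⁺ (All.tabulate λ i∈I →
                           AllP.concat⁺ (AllP.map⁺ (All.tabulate λ j∈I → single i∈I j∈I))))
    where
    single : ∀ {i j} → i ∈ₗ I → j ∈ₗ I → All Q (if i <ᵇ j then b i j ∷ [] else [])
    single {i} {j} i∈I j∈I with i <ᵇ j in i<ᵇj
    ... | false = []
    ... | true  = h i∈I j∈I (<ᵇ⇒< i j (subst T (sym i<ᵇj) _)) ∷ []

  module _ {P : Pred A ℓ′} (P? : Decidable P) where
    private
      hit : ℕ → ℕ → ℕ
      hit i j = length (filter P? (if i <ᵇ j then b i j ∷ [] else []))

      hit≡0 : ∀ {i j} → (i < j → ¬ P (b i j)) → hit i j ≡ 0
      hit≡0 {i} {j} ¬P with i <ᵇ j in i<ᵇj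
      ... | false = refl
      ... | true  = cong length (filter-reject P? (¬P (<ᵇ⇒< i j (subst T (sym i<ᵇj) _))))

      hit≡1 : ∀ {i j} → i < j → P (b i j) → hit i j ≡ 1
      hit≡1 {i} {j} i<j Pij with i <ᵇ j in i<ᵇj
      ... | false = ⊥-elim (subst T i<ᵇj (<⇒<ᵇ i<j))
      ... | true  = cong length (filter-accept P? Pij)

      count-as-sum : length (filter P? pairs) ≡ sum (map (λ i → sum (map (hit i) I)) I)
      count-as-sum = trans (length-filter-concatMap P? _ I)
                           (cong sum (map-cong (λ i → length-filter-concatMap P? _ I) I))

    count-pairs-≡0 : (∀ {i j} → i ∈ₗ I → j ∈ₗ I → i < j → ¬ P (b i j)) → length (filter P? pairs) ≡ 0
    count-pairs-≡0 none = trans count-as-sum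
      (sum-map-≡0 _ λ i∈I → sum-map-≡0 _ λ j∈I → hit≡0 (none i∈I j∈I))

    private
      count-pairs-ordered : ∀ {s t} → Unique I → s ∈ₗ I → t ∈ₗ I → s < t → P (b s t) →
        (∀ {i j} → i ∈ₗ I → j ∈ₗ I → i < j → P (b i j) → Covers i j s × Covers i j t) →
        length (filter P? pairs) ≡ 1
      count-pairs-ordered {s} {t} uniq s∈I t∈I s<t Pst only = begin
        length (filter P? pairs)                  ≡⟨ count-as-sum ⟩
        sum (map (λ i → sum (map (hit i) I)) I)  ≡⟨ sum-map-single _ uniq s∈I other-row ⟩
        sum (map (hit s) I)                       ≡⟨ sum-map-single _ uniq t∈I other-column ⟩
        hit s t                                   ≡⟨ hit≡1 s<t Pst ⟩
        1                                         ∎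
        where
        open ≡-Reasoning
        the-pair : ∀ {i j} → i ∈ₗ I → j ∈ₗ I → i < j → P (b i j) → i ≡ s × j ≡ t
        the-pair i∈I j∈I i<j Pij with only i∈I j∈I i<j Pij
        ... | cs , ct with covers-two (<⇒≢ s<t) cs ct
        ...   | inj₁ i≡s,j≡t      = i≡s,j≡t
        ...   | inj₂ (refl , refl) = contradiction s<t (<-asym i<j)
        other-row : ∀ {i} → i ∈ₗ I → i ≢ s → sum (map (hit i) I) ≡ 0
        other-row i∈I i≢s =
          sum-map-≡0 _ λ j∈I → hit≡0 λ i<j Pij → i≢s (proj₁ (the-pair i∈I j∈I i<j Pij))
        other-column : ∀ {j} → j ∈ₗ I → j ≢ t → hit s j ≡ 0
        other-column j∈I j≢t = hit≡0 λ s<j Psj → j≢t (proj₂ (the-pair s∈I j∈I s<j Psj))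

    count-pairs-≡1 : ∀ {s t} → Unique I → s ∈ₗ I → t ∈ₗ I → s ≢ t →
      (∀ {i j} → i ∈ₗ I → j ∈ₗ I → i < j → P (b i j) ⇔ (Covers i j s × Covers i j t)) →
      length (filter P? pairs) ≡ 1
    count-pairs-≡1 {s} {t} uniq s∈I t∈I s≢t exactly with <-cmp s t
    ... | tri< s<t _ _ = count-pairs-ordered uniq s∈I t∈I s<t
          (Equivalence.from (exactly s∈I t∈I s<t) (inj₁ refl , inj₂ refl))
          (λ i∈I j∈I i<j Pij → Equivalence.to (exactly i∈I j∈I i<j) Pij)
    ... | tri≈ _ s≡t _ = contradiction s≡t s≢t
    ... | tri> _ _ t<s = count-pairs-ordered uniq t∈I s∈I t<s
          (Equivalence.from (exactly t∈I s∈I t<s) (inj₂ refl , inj₁ refl))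
          (λ i∈I j∈I i<j Pij → swap (Equivalence.to (exactly i∈I j∈I i<j) Pij))

∈-⁅⁆∪⁻ : ∀ {n} {x y : Fin n} {q} → x ∈ ⁅ y ⁆ ∪ q → x ≡ y ⊎ x ∈ q
∈-⁅⁆∪⁻ {q = q} x∈ = Sum.map₁ (x∈⁅y⁆⇒x≡y _) (x∈p∪q⁻ _ q x∈)

∈-⁅⁆∪⁺ : ∀ {n} {x y : Fin n} {q} → x ≡ y ⊎ x ∈ q → x ∈ ⁅ y ⁆ ∪ q
∈-⁅⁆∪⁺ = x∈p∪q⁺ ∘ Sum.map₁ λ { refl → x∈⁅x⁆ _ }

∉-⁅⁆∪ : ∀ {n} {x y : Fin n} {q} → x ≢ y → x ∉ q → x ∉ ⁅ y ⁆ ∪ q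
∉-⁅⁆∪ x≢y x∉q = [ x≢y , x∉q ]′ ∘ ∈-⁅⁆∪⁻

∣⁅x⁆∪p∣≡1+∣p∣ : ∀ {n} {x : Fin n} {p} → x ∉ p → ∣ ⁅ x ⁆ ∪ p ∣ ≡ suc ∣ p ∣
∣⁅x⁆∪p∣≡1+∣p∣ {x = zero}  {inside  Vec.∷ p} x∉p = contradiction Vec.here x∉p
∣⁅x⁆∪p∣≡1+∣p∣ {x = zero}  {outside Vec.∷ p} x∉p = cong (suc ∘ ∣_∣) (∪-identityˡ p)
∣⁅x⁆∪p∣≡1+∣p∣ {x = suc x} {inside  Vec.∷ p} x∉p = cong suc (∣⁅x⁆∪p∣≡1+∣p∣ (x∉p ∘ Vec.there))
∣⁅x⁆∪p∣≡1+∣p∣ {x = suc x} {outside Vec.∷ p} x∉p = ∣⁅x⁆∪p∣≡1+∣p∣ (x∉p ∘ Vec.there)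

elements : ∀ {n} → Subset n → List (Fin n)
elements Vec.[]          = []
elements (inside  Vec.∷ p) = zero ∷ map suc (elements p)
elements (outside Vec.∷ p) = map suc (elements p)

length-elements : ∀ {n} (p : Subset n) → length (elements p) ≡ ∣ p ∣
length-elements Vec.[]            = refl
length-elements (inside  Vec.∷ p) = cong suc (trans (length-map suc (elements p)) (length-elements p))
length-elements (outside Vec.∷ p) = trans (length-map suc (elements p)) (length-elements p)

elements-unique : ∀ {n} (p : Subset n) → Unique (elements p)
elements-unique Vec.[]            = []
elements-unique (inside  Vec.∷ p) =
  AllP.map⁺ (All.universal (λ _ ()) (elements p)) ∷ Unique.map⁺ Fin.suc-injective (elements-unique p)
elements-unique (outside Vec.∷ p) = Unique.map⁺ Fin.suc-injective (elements-unique p)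

⋃-map-⁅suc⁆ : ∀ {n} (xs : List (Fin n)) → ⋃ (map ⁅_⁆ (map suc xs)) ≡ outside Vec.∷ ⋃ (map ⁅_⁆ xs)
⋃-map-⁅suc⁆ []       = refl
⋃-map-⁅suc⁆ (x ∷ xs) = cong (⁅ suc x ⁆ ∪_) (⋃-map-⁅suc⁆ xs)

⋃-elements : ∀ {n} (p : Subset n) → ⋃ (map ⁅_⁆ (elements p)) ≡ p
⋃-elements Vec.[]            = refl
⋃-elements (inside  Vec.∷ p) = begin
  ⁅ zero ⁆ ∪ ⋃ (map ⁅_⁆ (map suc (elements p))) ≡⟨ cong (⁅ zero ⁆ ∪_) (⋃-map-⁅suc⁆ (elements p)) ⟩
  inside Vec.∷ (⊥ ∪ ⋃ (map ⁅_⁆ (elements p)))    ≡⟨ cong (inside Vec.∷_) (∪-identityˡ _) ⟩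
  inside Vec.∷ ⋃ (map ⁅_⁆ (elements p))          ≡⟨ cong (inside Vec.∷_) (⋃-elements p) ⟩
  inside Vec.∷ p                                 ∎
  where open ≡-Reasoning
⋃-elements (outside Vec.∷ p) = trans (⋃-map-⁅suc⁆ (elements p)) (cong (outside Vec.∷_) (⋃-elements p))

triple : ∀ {n} → Fin n → Fin n → Fin n → Subset n
triple x y z = ⁅ x ⁆ ∪ ⁅ y ⁆ ∪ ⁅ z ⁆

list-of-three : ∀ (xs : List A) → Unique xs → length xs ≡ 3 →
  ∃[ x ] ∃[ y ] ∃[ z ] (x ≢ y × x ≢ z × y ≢ z × xs ≡ x ∷ y ∷ z ∷ [])
list-of-three (x ∷ y ∷ z ∷ []) ((x≢y ∷ x≢z ∷ []) ∷ (y≢z ∷ []) ∷ _) _ =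
  x , y , z , x≢y , x≢z , y≢z , refl

three-elements : ∀ {n} (T : Subset n) → ∣ T ∣ ≡ 3 →
  ∃[ x ] ∃[ y ] ∃[ z ] (x ≢ y × x ≢ z × y ≢ z × T ≡ triple x y z)
three-elements T ∣T∣≡3
  with x , y , z , x≢y , x≢z , y≢z , T≡xyz
         ← list-of-three (elements T) (elements-unique T) (trans (length-elements T) ∣T∣≡3)
  = x , y , z , x≢y , x≢z , y≢z , (begin
  T                           ≡⟨ ⋃-elements T ⟨
  ⋃ (map ⁅_⁆ (elements T))    ≡⟨ cong (⋃ ∘ map ⁅_⁆) T≡xyz ⟩
  ⁅ x ⁆ ∪ ⁅ y ⁆ ∪ ⁅ z ⁆ ∪ ⊥   ≡⟨ cong (λ q → ⁅ x ⁆ ∪ ⁅ y ⁆ ∪ q) (∪-identityʳ ⁅ z ⁆) ⟩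
  triple x y z                ∎)
  where open ≡-Reasoning

∣triple∣≡3 : ∀ {n} (x y z : Fin n) → x ≢ y → x ≢ z → y ≢ z → ∣ triple x y z ∣ ≡ 3
∣triple∣≡3 _ _ z x≢y x≢z y≢z =
  trans (∣⁅x⁆∪p∣≡1+∣p∣ (∉-⁅⁆∪ x≢y (x≢z ∘ x∈⁅y⁆⇒x≡y _)))
        (cong suc (trans (∣⁅x⁆∪p∣≡1+∣p∣ (y≢z ∘ x∈⁅y⁆⇒x≡y _)) (cong suc (∣⁅x⁆∣≡1 z))))

triple⊆⇔ : ∀ {n} {x y z : Fin n} {q} → triple x y z ⊆ q ⇔ (x ∈ q × y ∈ q × z ∈ q)
triple⊆⇔ {x = x} {y} {z} {q} = mk⇔ to from
  where
  to : triple x y z ⊆ q → x ∈ q × y ∈ q × z ∈ q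
  to xyz⊆q = xyz⊆q (∈-⁅⁆∪⁺ (inj₁ refl)) , xyz⊆q (∈-⁅⁆∪⁺ (inj₂ (∈-⁅⁆∪⁺ (inj₁ refl)))) ,
             xyz⊆q (∈-⁅⁆∪⁺ (inj₂ (∈-⁅⁆∪⁺ (inj₂ (x∈⁅x⁆ z)))))
  from : x ∈ q × y ∈ q × z ∈ q → triple x y z ⊆ q
  from (x∈q , y∈q , z∈q) w∈xyz with ∈-⁅⁆∪⁻ w∈xyz
  ... | inj₁ refl = x∈q
  ... | inj₂ w∈yz with ∈-⁅⁆∪⁻ w∈yz
  ...   | inj₁ refl = y∈q
  ...   | inj₂ w∈z rewrite x∈⁅y⁆⇒x≡y z w∈z = z∈q

triple-swap₂₃ : ∀ {n} (x y z : Fin n) → triple x y z ≡ triple x z y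
triple-swap₂₃ x y z = cong (⁅ x ⁆ ∪_) (∪-comm ⁅ y ⁆ ⁅ z ⁆)

triple-rotate : ∀ {n} (x y z : Fin n) → triple x y z ≡ triple y z x
triple-rotate x y z = trans (∪-comm ⁅ x ⁆ (⁅ y ⁆ ∪ ⁅ z ⁆)) (∪-assoc ⁅ y ⁆ ⁅ z ⁆ ⁅ x ⁆)

-- Congruence modulo n

-- A record rather than a function into _≡_, so that its two sides can be inferred: x % n
-- unfolds to a term that does not determine x.
infix 4 _≡_mod_
record _≡_mod_ (x y n : ℕ) .{{_ : NonZero n}} : Set where
  constructor mod-≡
  field %-≡ : x % n ≡ y % n
open _≡_mod_

module _ {n : ℕ} .{{_ : NonZero n}} where

  ≡-mod-isEquivalence : IsEquivalence (λ x y → x ≡ y mod n)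
  ≡-mod-isEquivalence = record
    { refl  = mod-≡ refl
    ; sym   = λ x≡y → mod-≡ (sym (%-≡ x≡y))
    ; trans = λ x≡y y≡z → mod-≡ (trans (%-≡ x≡y) (%-≡ y≡z))
    }

  ≡-mod-setoid : Setoid 0ℓ 0ℓ
  ≡-mod-setoid = record { isEquivalence = ≡-mod-isEquivalence }

  open IsEquivalence ≡-mod-isEquivalence public
    using () renaming (refl to ≡-mod-refl; sym to ≡-mod-sym; trans to ≡-mod-trans)

  module ≡-mod-Reasoning = SetoidReasoning ≡-mod-setoid

  ≡⇒≡-mod : ∀ {x y} → x ≡ y → x ≡ y mod n
  ≡⇒≡-mod refl = ≡-mod-refl

  %-≡-mod : ∀ x → x % n ≡ x mod n
  %-≡-mod x = mod-≡ (m%n%n≡m%n x n)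

  +n-≡-mod : ∀ x → x + n ≡ x mod n
  +n-≡-mod x = mod-≡ ([m+n]%n≡m%n x n)

  n≡0-mod : n ≡ 0 mod n
  n≡0-mod = mod-≡ (trans (n%n≡0 n) (sym (m<n⇒m%n≡m (>-nonZero⁻¹ n))))

  +-cong-mod : ∀ {a b c d} → a ≡ b mod n → c ≡ d mod n → a + c ≡ b + d mod n
  +-cong-mod {a} {b} {c} {d} (mod-≡ a≡b) (mod-≡ c≡d) = mod-≡ (begin
    (a + c) % n             ≡⟨ %-distribˡ-+ a c n ⟩
    (a % n + c % n) % n     ≡⟨ cong₂ (λ u v → (u + v) % n) a≡b c≡d ⟩
    (b % n + d % n) % n     ≡⟨ %-distribˡ-+ b d n ⟨
    (b + d) % n             ∎)
    where open ≡-Reasoning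

  +-congˡ-mod : ∀ k {a b} → a ≡ b mod n → k + a ≡ k + b mod n
  +-congˡ-mod k = +-cong-mod ≡-mod-refl

  *-congˡ-mod : ∀ k {a b} → a ≡ b mod n → k * a ≡ k * b mod n
  *-congˡ-mod k {a} {b} (mod-≡ a≡b) = mod-≡ (begin
    (k * a) % n             ≡⟨ %-distribˡ-* k a n ⟩
    (k % n * (a % n)) % n   ≡⟨ cong (λ u → (k % n * u) % n) a≡b ⟩
    (k % n * (b % n)) % n   ≡⟨ %-distribˡ-* k b n ⟨
    (k * b) % n             ∎)
    where open ≡-Reasoning

  +-cancelˡ-mod : ∀ k {a b} → k + a ≡ k + b mod n → a ≡ b mod n
  +-cancelˡ-mod k {a} {b} k+a≡k+b = begin
    a                        ≈⟨ undo a ⟨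
    (n ∸ k % n) + (k + a)    ≈⟨ +-congˡ-mod (n ∸ k % n) k+a≡k+b ⟩
    (n ∸ k % n) + (k + b)    ≈⟨ undo b ⟩
    b                        ∎
    where
    open ≡-mod-Reasoning
    undo : ∀ x → (n ∸ k % n) + (k + x) ≡ x mod n
    undo x = begin
      (n ∸ k % n) + (k + x)      ≈⟨ +-congˡ-mod (n ∸ k % n) (+-cong-mod (%-≡-mod k) ≡-mod-refl) ⟨
      (n ∸ k % n) + (k % n + x)  ≡⟨ +-assoc (n ∸ k % n) (k % n) x ⟨
      (n ∸ k % n) + k % n + x    ≡⟨ cong (_+ x) (m∸n+n≡m (m%n≤n k n)) ⟩
      n + x                      ≡⟨ +-comm n x ⟩
      x + n                      ≈⟨ +n-≡-mod x ⟩
      x                          ∎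

  +-cancelʳ-mod : ∀ k {a b} → a + k ≡ b + k mod n → a ≡ b mod n
  +-cancelʳ-mod k {a} {b} a+k≡b+k = +-cancelˡ-mod k (begin
    k + a  ≡⟨ +-comm k a ⟩
    a + k  ≈⟨ a+k≡b+k ⟩
    b + k  ≡⟨ +-comm b k ⟩
    k + b  ∎)
    where open ≡-mod-Reasoning

  ≡-mod⇒≡ : ∀ {a b} → a < n → b < n → a ≡ b mod n → a ≡ b
  ≡-mod⇒≡ a<n b<n (mod-≡ a≡b) = trans (sym (m<n⇒m%n≡m a<n)) (trans a≡b (m<n⇒m%n≡m b<n))

  *-cancelˡ-mod : ∀ {k} → Coprime n k → ∀ {a b} → k * a ≡ k * b mod n → a ≡ b mod n
  *-cancelˡ-mod {k} n⊥k {a} {b} ka≡kb =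
    [ (λ b≤a → cancel b≤a ka≡kb) , (λ a≤b → ≡-mod-sym (cancel a≤b (≡-mod-sym ka≡kb))) ]′ (≤-total b a)
    where
    cancel : ∀ {a b} → b ≤ a → k * a ≡ k * b mod n → a ≡ b mod n
    cancel {a} {b} b≤a ka≡kb = begin
      a            ≡⟨ m+[n∸m]≡n b≤a ⟨
      b + (a ∸ b)  ≈⟨ mod-≡ (%-remove-+ʳ b n∣a∸b) ⟩
      b            ∎
      where
      open ≡-mod-Reasoning
      k[a∸b]≡0 : k * (a ∸ b) ≡ 0 mod n
      k[a∸b]≡0 = +-cancelˡ-mod (k * b) (begin
        k * b + k * (a ∸ b)  ≡⟨ *-distribˡ-+ k b (a ∸ b) ⟨
        k * (b + (a ∸ b))    ≡⟨ cong (k *_) (m+[n∸m]≡n b≤a) ⟩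
        k * a                ≈⟨ ka≡kb ⟩
        k * b                ≡⟨ +-identityʳ (k * b) ⟨
        k * b + 0            ∎)
      n∣a∸b : n ∣ a ∸ b
      n∣a∸b = coprime-divisor n⊥k (m%n≡0⇒n∣m _ n (trans (%-≡ k[a∸b]≡0) (m<n⇒m%n≡m (>-nonZero⁻¹ n))))

prime∤⇒coprime : ∀ {p n} → Prime p → p ∤ n → Coprime n p
prime∤⇒coprime prime-p p∤n (d∣n , d∣p) with prime⇒irreducible prime-p d∣p
... | inj₁ d≡1 = d≡1
... | inj₂ refl = contradiction d∣n p∤n

-- The cycle ℤ_n for odd n = 2m + 1

module OddCycle (m : ℕ) where

  n : ℕ
  n = suc (m + m)

  m<n : m < n
  m<n = s≤s (m≤m+n m m)

  ≤m⇒<n : ∀ {i} → i ≤ m → i < n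
  ≤m⇒<n i≤m = ≤-<-trans i≤m m<n

  m<n∸i : ∀ {i} → i ≤ m → m < n ∸ i
  m<n∸i {i} i≤m = begin-strict
    m                 ≤⟨ m≤m+n m (m ∸ i) ⟩
    m + (m ∸ i)       <⟨ n<1+n _ ⟩
    suc (m + (m ∸ i)) ≡⟨ cong suc (+-∸-assoc m i≤m) ⟨
    suc (m + m ∸ i)   ≡⟨ +-∸-assoc 1 (≤-trans i≤m (m≤m+n m m)) ⟨
    n ∸ i             ∎
    where open ≤-Reasoning

  -- norm, offset and mid are opaque so that they stay rigid for unification; outside their
  -- blocks only the lemmas proved alongside them are used.
  opaque
    norm : ℕ → ℕ
    norm r = r ⊓ (n ∸ r)

    norm-≤ : ∀ r → norm r ≤ m
    norm-≤ r with r ≤? m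
    ... | yes r≤m = ≤-trans (m⊓n≤m r (n ∸ r)) r≤m
    ... | no  r≰m = begin
      norm r    ≤⟨ m⊓n≤n r (n ∸ r) ⟩
      n ∸ r     ≤⟨ ∸-monoʳ-≤ n (≰⇒> r≰m) ⟩
      m + m ∸ m ≡⟨ m+n∸m≡n m m ⟩
      m         ∎
      where open ≤-Reasoning

    norm-small : ∀ {r} → r ≤ m → norm r ≡ r
    norm-small r≤m = m≤n⇒m⊓n≡m (<⇒≤ (≤-<-trans r≤m (m<n∸i r≤m)))

    norm-∸ : ∀ {r} → r ≤ n → norm (n ∸ r) ≡ norm r
    norm-∸ {r} r≤n = trans (cong ((n ∸ r) ⊓_) (m∸[m∸n]≡n r≤n)) (⊓-comm (n ∸ r) r)

    norm-injective : ∀ {r s} → r < n → s < n → norm r ≡ norm s → r ≡ s ⊎ r + s ≡ n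
    norm-injective {r} {s} r<n s<n eq with ⊓-sel r (n ∸ r) | ⊓-sel s (n ∸ s)
    ... | inj₁ ∣r∣≡r   | inj₁ ∣s∣≡s   = inj₁ (trans (sym ∣r∣≡r) (trans eq ∣s∣≡s))
    ... | inj₁ ∣r∣≡r   | inj₂ ∣s∣≡n∸s = inj₂ (trans
            (cong (_+ s) (trans (sym ∣r∣≡r) (trans eq ∣s∣≡n∸s))) (m∸n+n≡m (<⇒≤ s<n)))
    ... | inj₂ ∣r∣≡n∸r | inj₁ ∣s∣≡s   = inj₂ (trans
            (cong (r +_) (trans (sym ∣s∣≡s) (trans (sym eq) ∣r∣≡n∸r))) (m+[n∸m]≡n (<⇒≤ r<n)))
    ... | inj₂ ∣r∣≡n∸r | inj₂ ∣s∣≡n∸s = inj₁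
            (∸-cancelˡ-≡ (<⇒≤ r<n) (<⇒≤ s<n) (trans (sym ∣r∣≡n∸r) (trans eq ∣s∣≡n∸s)))

  norm-neg : ∀ {r s} → r < n → s < n → r + s ≡ 0 mod n → norm r ≡ norm s
  norm-neg {r} {zero}  r<n _   r+0≡0 =
    cong norm (≡-mod⇒≡ r<n (>-nonZero⁻¹ n) (≡-mod-trans (≡⇒≡-mod (sym (+-identityʳ r))) r+0≡0))
  norm-neg {r} {suc s} r<n s<n r+s≡0 = trans (cong norm r≡n∸s) (norm-∸ (<⇒≤ s<n))
    where
    open ≡-mod-Reasoning
    r≡n∸s : r ≡ n ∸ suc s
    r≡n∸s = ≡-mod⇒≡ r<n (∸-monoʳ-< (s≤s z≤n) (<⇒≤ s<n)) (+-cancelʳ-mod (suc s) (begin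
      r + suc s        ≈⟨ r+s≡0 ⟩
      0                ≈⟨ n≡0-mod ⟨
      n                ≡⟨ m∸n+n≡m (<⇒≤ s<n) ⟨
      n ∸ suc s + suc s ∎))

  opaque
    offset : Fin n → Fin n → ℕ
    offset a p = (toℕ p + (n ∸ toℕ a)) % n

    offset<n : ∀ a p → offset a p < n
    offset<n a p = m%n<n (toℕ p + (n ∸ toℕ a)) n

    offset-spec : ∀ a p → toℕ a + offset a p ≡ toℕ p mod n
    offset-spec a p = begin
      toℕ a + offset a p                ≈⟨ +-congˡ-mod (toℕ a) (%-≡-mod (toℕ p + (n ∸ toℕ a))) ⟩
      toℕ a + (toℕ p + (n ∸ toℕ a))     ≡⟨ x∙yz≈y∙xz (toℕ a) (toℕ p) (n ∸ toℕ a) ⟩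
      toℕ p + (toℕ a + (n ∸ toℕ a))     ≡⟨ cong (toℕ p +_) (m+[n∸m]≡n (<⇒≤ (toℕ<n a))) ⟩
      toℕ p + n                         ≈⟨ +n-≡-mod (toℕ p) ⟩
      toℕ p                             ∎
      where open ≡-mod-Reasoning

  offset-unique : ∀ {a p c} → c < n → toℕ a + c ≡ toℕ p mod n → offset a p ≡ c
  offset-unique {a} {p} c<n a+c≡p =
    ≡-mod⇒≡ (offset<n a p) c<n (+-cancelˡ-mod (toℕ a) (≡-mod-trans (offset-spec a p) (≡-mod-sym a+c≡p)))

  offset-injective : ∀ {a p q} → offset a p ≡ offset a q → p ≡ q
  offset-injective {a} {p} {q} eq = toℕ-injective (≡-mod⇒≡ (toℕ<n p) (toℕ<n q) (begin
    toℕ p                ≈⟨ offset-spec a p ⟨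
    toℕ a + offset a p   ≡⟨ cong (toℕ a +_) eq ⟩
    toℕ a + offset a q   ≈⟨ offset-spec a q ⟩
    toℕ q                ∎))
    where open ≡-mod-Reasoning

  offset-self : ∀ a → offset a a ≡ 0
  offset-self a = offset-unique (>-nonZero⁻¹ n) (≡⇒≡-mod (+-identityʳ (toℕ a)))

  offset-plusMod : ∀ {a i} → i < n → offset a (plusMod n a i) ≡ i
  offset-plusMod {a} {i} i<n = offset-unique i<n (begin
    toℕ a + i                  ≈⟨ %-≡-mod (toℕ a + i) ⟨
    (toℕ a + i) % n            ≡⟨ toℕ-fromℕ< _ ⟨
    toℕ (plusMod n a i)        ∎)
    where open ≡-mod-Reasoning

  offset-minusMod : ∀ {a i} → 0 < i → i < n → offset a (minusMod n a i) ≡ n ∸ i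
  offset-minusMod {a} {i} 0<i i<n = offset-unique (∸-monoʳ-< 0<i (<⇒≤ i<n)) (begin
    toℕ a + (n ∸ i)                              ≡⟨ cong (λ u → toℕ a + (n ∸ u)) i%n≡i ⟨
    toℕ a + (n ∸ toℕ (i DivMod.mod n))           ≈⟨ %-≡-mod (toℕ a + (n ∸ toℕ (i DivMod.mod n))) ⟨
    (toℕ a + (n ∸ toℕ (i DivMod.mod n))) % n     ≡⟨ toℕ-fromℕ< _ ⟨
    toℕ (minusMod n a i)                         ∎)
    where
    open ≡-mod-Reasoning
    i%n≡i : toℕ (i DivMod.mod n) ≡ i
    i%n≡i = trans (toℕ-fromℕ< _) (m<n⇒m%n≡m i<n)

  dist : Fin n → Fin n → ℕ
  dist a p = norm (offset a p)

  dist≡0⇒≡ : ∀ {a p} → dist a p ≡ 0 → p ≡ a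
  dist≡0⇒≡ {a} {p} d≡0 with norm-injective (offset<n a p) (>-nonZero⁻¹ n) (trans d≡0 (sym (norm-small z≤n)))
  ... | inj₁ r≡0   = offset-injective (trans r≡0 (sym (offset-self a)))
  ... | inj₂ r+0≡n = contradiction (trans (sym (+-identityʳ _)) r+0≡n) (<⇒≢ (offset<n a p))

  dist-self : ∀ a → dist a a ≡ 0
  dist-self a = trans (cong norm (offset-self a)) (norm-small z≤n)

  dist-plusMod : ∀ {a i} → i ≤ m → dist a (plusMod n a i) ≡ i
  dist-plusMod i≤m = trans (cong norm (offset-plusMod (≤m⇒<n i≤m))) (norm-small i≤m)

  dist-minusMod : ∀ {a i} → 0 < i → i ≤ m → dist a (minusMod n a i) ≡ i
  dist-minusMod {a} {i} 0<i i≤m = begin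
    norm (offset a (minusMod n a i))  ≡⟨ cong norm (offset-minusMod 0<i (≤m⇒<n i≤m)) ⟩
    norm (n ∸ i)                      ≡⟨ norm-∸ (<⇒≤ (≤m⇒<n i≤m)) ⟩
    norm i                            ≡⟨ norm-small i≤m ⟩
    i                                 ∎
    where open ≡-Reasoning

  dist≡⇒ : ∀ {a p i} → 0 < i → i ≤ m → dist a p ≡ i → p ≡ minusMod n a i ⊎ p ≡ plusMod n a i
  dist≡⇒ {a} {p} {i} 0<i i≤m d≡i
    with norm-injective (offset<n a p) (≤m⇒<n i≤m) (trans d≡i (sym (norm-small i≤m)))
  ... | inj₁ r≡i   = inj₂ (offset-injective (trans r≡i (sym (offset-plusMod (≤m⇒<n i≤m)))))
  ... | inj₂ r+i≡n = inj₁ (offset-injective (begin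
    offset a p              ≡⟨ m+n∸n≡m (offset a p) i ⟨
    offset a p + i ∸ i      ≡⟨ cong (_∸ i) r+i≡n ⟩
    n ∸ i                   ≡⟨ offset-minusMod 0<i (≤m⇒<n i≤m) ⟨
    offset a (minusMod n a i) ∎))
    where open ≡-Reasoning

  minusMod≢plusMod : ∀ a {i} → 0 < i → i ≤ m → minusMod n a i ≢ plusMod n a i
  minusMod≢plusMod a {i} 0<i i≤m eq = <⇒≢ (≤-<-trans i≤m (m<n∸i i≤m)) (begin
    i                          ≡⟨ offset-plusMod (≤m⇒<n i≤m) ⟨
    offset a (plusMod n a i)   ≡⟨ cong (offset a) eq ⟨
    offset a (minusMod n a i)  ≡⟨ offset-minusMod 0<i (≤m⇒<n i≤m) ⟩
    n ∸ i                      ∎)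
    where open ≡-Reasoning

  -- suc m is the inverse of 2 modulo n.
  opaque
    mid : Fin n → Fin n → Fin n
    mid x y = (suc m * (toℕ x + toℕ y)) DivMod.mod n

    toℕ-mid : ∀ x y → toℕ (mid x y) ≡ suc m * (toℕ x + toℕ y) mod n
    toℕ-mid x y = ≡-mod-trans (≡⇒≡-mod (toℕ-fromℕ< _)) (%-≡-mod (suc m * (toℕ x + toℕ y)))

  halve : ∀ s → suc m * (s + s) ≡ s mod n
  halve s = begin
    suc m * (s + s)  ≡⟨ expand m s ⟩
    s + s * n        ≈⟨ mod-≡ ([m+kn]%n≡m%n s s n) ⟩
    s                ∎
    where
    open ≡-mod-Reasoning
    expand : ∀ k s → suc k * (s + s) ≡ s + s * suc (k + k)
    expand = solve-∀

  mid-spec : ∀ x y → toℕ (mid x y) + toℕ (mid x y) ≡ toℕ x + toℕ y mod n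
  mid-spec x y = begin
    toℕ (mid x y) + toℕ (mid x y)                  ≈⟨ +-cong-mod (toℕ-mid x y) (toℕ-mid x y) ⟩
    suc m * (toℕ x + toℕ y) + suc m * (toℕ x + toℕ y) ≡⟨ *-distribˡ-+ (suc m) (toℕ x + toℕ y) _ ⟨
    suc m * (toℕ x + toℕ y + (toℕ x + toℕ y))      ≈⟨ halve (toℕ x + toℕ y) ⟩
    toℕ x + toℕ y                                  ∎
    where open ≡-mod-Reasoning

  mid-unique : ∀ {a x y} → toℕ a + toℕ a ≡ toℕ x + toℕ y mod n → a ≡ mid x y
  mid-unique {a} {x} {y} 2a≡x+y = toℕ-injective (≡-mod⇒≡ (toℕ<n a) (toℕ<n (mid x y)) (begin
    toℕ a                     ≈⟨ halve (toℕ a) ⟨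
    suc m * (toℕ a + toℕ a)   ≈⟨ *-congˡ-mod (suc m) 2a≡x+y ⟩
    suc m * (toℕ x + toℕ y)   ≈⟨ toℕ-mid x y ⟨
    toℕ (mid x y)             ∎))
    where open ≡-mod-Reasoning

  mid-comm : ∀ x y → mid x y ≡ mid y x
  mid-comm x y = mid-unique (≡-mod-trans (mid-spec x y) (≡⇒≡-mod (+-comm (toℕ x) (toℕ y))))

  mid-injectiveʳ : ∀ {x y z} → mid x y ≡ mid x z → y ≡ z
  mid-injectiveʳ {x} {y} {z} eq = toℕ-injective (≡-mod⇒≡ (toℕ<n y) (toℕ<n z) (+-cancelˡ-mod (toℕ x) (begin
    toℕ x + toℕ y                  ≈⟨ mid-spec x y ⟨
    toℕ (mid x y) + toℕ (mid x y)  ≡⟨ cong (λ c → toℕ c + toℕ c) eq ⟩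
    toℕ (mid x z) + toℕ (mid x z)  ≈⟨ mid-spec x z ⟩
    toℕ x + toℕ z                  ∎)))
    where open ≡-mod-Reasoning

  dist-≡⇒mid : ∀ {a p q} → p ≢ q → dist a p ≡ dist a q → a ≡ mid p q
  dist-≡⇒mid {a} {p} {q} p≢q eq with norm-injective (offset<n a p) (offset<n a q) eq
  ... | inj₁ r≡s   = contradiction (offset-injective r≡s) p≢q
  ... | inj₂ r+s≡n = mid-unique (begin
    toℕ a + toℕ a                                ≈⟨ +n-≡-mod (toℕ a + toℕ a) ⟨
    toℕ a + toℕ a + n                            ≡⟨ cong (toℕ a + toℕ a +_) r+s≡n ⟨
    toℕ a + toℕ a + (offset a p + offset a q)    ≡⟨ interchange (toℕ a) (toℕ a) (offset a p) (offset a q) ⟩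
    (toℕ a + offset a p) + (toℕ a + offset a q)  ≈⟨ +-cong-mod (offset-spec a p) (offset-spec a q) ⟩
    toℕ p + toℕ q                                ∎)
    where open ≡-mod-Reasoning

  mid⇒dist-≡ : ∀ {a p q} → a ≡ mid p q → dist a p ≡ dist a q
  mid⇒dist-≡ {p = p} {q} refl = norm-neg (offset<n a p) (offset<n a q) (+-cancelˡ-mod (toℕ a + toℕ a) (begin
    toℕ a + toℕ a + (offset a p + offset a q)    ≡⟨ interchange (toℕ a) (toℕ a) (offset a p) (offset a q) ⟩
    (toℕ a + offset a p) + (toℕ a + offset a q)  ≈⟨ +-cong-mod (offset-spec a p) (offset-spec a q) ⟩
    toℕ p + toℕ q                                ≈⟨ mid-spec p q ⟨
    toℕ a + toℕ a                                ≡⟨ +-identityʳ (toℕ a + toℕ a) ⟨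
    toℕ a + toℕ a + 0                            ∎))
    where
    open ≡-mod-Reasoning
    a : Fin n
    a = mid p q

  dist-≤ : ∀ a p → dist a p ≤ m
  dist-≤ a p = norm-≤ (offset a p)

  IsRadius : ℕ → Set
  IsRadius i = 0 < i × i ≤ m

  dist-isRadius : ∀ {a p} → p ≢ a → IsRadius (dist a p)
  dist-isRadius {a} {p} p≢a = n≢0⇒n>0 (p≢a ∘ dist≡0⇒≡) , dist-≤ a p

  ∈-block⇔ : ∀ {a p i j} → IsRadius i → IsRadius j → p ∈ block n a i j ⇔ Covers i j (dist a p)
  ∈-block⇔ {a} {p} {i} {j} (0<i , i≤m) (0<j , j≤m) = mk⇔ to from
    where
    to : p ∈ block n a i j → Covers i j (dist a p)
    to p∈ with ∈-⁅⁆∪⁻ p∈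
    ... | inj₁ refl = inj₁ (dist-minusMod 0<i i≤m)
    ... | inj₂ p∈′ with ∈-⁅⁆∪⁻ p∈′
    ...   | inj₁ refl = inj₁ (dist-plusMod i≤m)
    ...   | inj₂ p∈″ with ∈-⁅⁆∪⁻ p∈″
    ...     | inj₁ refl = inj₂ (dist-minusMod 0<j j≤m)
    ...     | inj₂ p∈⁅a+j⁆ rewrite x∈⁅y⁆⇒x≡y _ p∈⁅a+j⁆ = inj₂ (dist-plusMod j≤m)
    from : Covers i j (dist a p) → p ∈ block n a i j
    from (inj₁ d≡i) with dist≡⇒ 0<i i≤m d≡i
    ... | inj₁ refl = ∈-⁅⁆∪⁺ (inj₁ refl)
    ... | inj₂ refl = ∈-⁅⁆∪⁺ (inj₂ (∈-⁅⁆∪⁺ (inj₁ refl)))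
    from (inj₂ d≡j) with dist≡⇒ 0<j j≤m d≡j
    ... | inj₁ refl = ∈-⁅⁆∪⁺ (inj₂ (∈-⁅⁆∪⁺ (inj₂ (∈-⁅⁆∪⁺ (inj₁ refl)))))
    ... | inj₂ refl = ∈-⁅⁆∪⁺ (inj₂ (∈-⁅⁆∪⁺ (inj₂ (∈-⁅⁆∪⁺ (inj₂ (x∈⁅x⁆ _))))))

  ∣block∣≡4 : ∀ a {i j} → 0 < i → i < j → j ≤ m → ∣ block n a i j ∣ ≡ 4
  ∣block∣≡4 a {i} {j} 0<i i<j j≤m =
    trans (∣⁅x⁆∪p∣≡1+∣p∣ (∉-⁅⁆∪ (minusMod≢plusMod a 0<i i≤m)
                          (∉-⁅⁆∪ (apart d[a-i] d[a-j]) (x≢y⇒x∉⁅y⁆ (apart d[a-i] d[a+j])))))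
    (cong suc (trans (∣⁅x⁆∪p∣≡1+∣p∣ (∉-⁅⁆∪ (apart d[a+i] d[a-j]) (x≢y⇒x∉⁅y⁆ (apart d[a+i] d[a+j]))))
    (cong suc (trans (∣⁅x⁆∪p∣≡1+∣p∣ (x≢y⇒x∉⁅y⁆ (minusMod≢plusMod a 0<j j≤m)))
    (cong suc (∣⁅x⁆∣≡1 (plusMod n a j)))))))
    where
    i≤m : i ≤ m
    i≤m = ≤-trans (<⇒≤ i<j) j≤m
    0<j : 0 < j
    0<j = <-trans 0<i i<j
    apart : ∀ {p q} → dist a p ≡ i → dist a q ≡ j → p ≢ q
    apart dp≡i dq≡j refl = <⇒≢ i<j (trans (sym dp≡i) dq≡j)
    d[a-i] : dist a (minusMod n a i) ≡ i
    d[a-i] = dist-minusMod 0<i i≤m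
    d[a+i] : dist a (plusMod n a i) ≡ i
    d[a+i] = dist-plusMod i≤m
    d[a-j] : dist a (minusMod n a j) ≡ j
    d[a-j] = dist-minusMod 0<j j≤m
    d[a+j] : dist a (plusMod n a j) ≡ j
    d[a+j] = dist-plusMod j≤m

  [m+m]/2≡m : (m + m) / 2 ≡ m
  [m+m]/2≡m = trans (cong (_/ 2) (trans (cong (m +_) (sym (+-identityʳ m))) (*-comm 2 m))) (m*n/n≡m m 2)

  ∈-indices⁻ : ∀ {i} → i ∈ₗ indices n → IsRadius i
  ∈-indices⁻ i∈ with k , k∈ , refl ← ∈-map⁻ suc i∈ = s≤s z≤n , subst (k <_) [m+m]/2≡m (∈-upTo⁻ k∈)

  ∈-indices⁺ : ∀ {i} → IsRadius i → i ∈ₗ indices n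
  ∈-indices⁺ {suc k} (_ , k<m) = ∈-map⁺ suc (∈-upTo⁺ (subst (k <_) (sym [m+m]/2≡m) k<m))

  indices-unique : Unique (indices n)
  indices-unique = Unique.map⁺ suc-injective (Unique.upTo⁺ _)

  ∣Ba∣≡4 : ∀ a → All (λ b → ∣ b ∣ ≡ 4) (Ba n a)
  ∣Ba∣≡4 a = All-pairs⁺ (indices n) (block n a) λ i∈ j∈ i<j →
    ∣block∣≡4 a (proj₁ (∈-indices⁻ i∈)) i<j (proj₂ (∈-indices⁻ j∈))

  triple⊆block⇔ : ∀ {a x y z i j} → IsRadius i → IsRadius j →
    triple x y z ⊆ block n a i j ⇔ (Covers i j (dist a x) × Covers i j (dist a y) × Covers i j (dist a z))
  triple⊆block⇔ {a} {i = i} {j} ri rj = mk⇔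
    (Product.map to (Product.map to to) ∘ Equivalence.to triple⊆⇔)
    (Equivalence.from triple⊆⇔ ∘ Product.map from (Product.map from from))
    where
    to : ∀ {p} → p ∈ block n a i j → Covers i j (dist a p)
    to = Equivalence.to (∈-block⇔ ri rj)
    from : ∀ {p} → Covers i j (dist a p) → p ∈ block n a i j
    from = Equivalence.from (∈-block⇔ ri rj)

  occurrences-Ba-apex : ∀ {a x y z} → x ≢ y → x ≢ z → y ≢ z → a ≡ mid x y →
                        occurrences (triple x y z) (Ba n a) ≡ 𝟙 (¬? (z ≟ᶠ a))
  occurrences-Ba-apex {a} {x} {y} {z} x≢y x≢z y≢z a≡mid = by-cases (z ≟ᶠ a)
    where
    covers : ∀ {i j} → i ∈ₗ indices n → j ∈ₗ indices n →
             triple x y z ⊆ block n a i j ⇔ (Covers i j (dist a x) × Covers i j (dist a y) × Covers i j (dist a z))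
    covers i∈ j∈ = triple⊆block⇔ (∈-indices⁻ i∈) (∈-indices⁻ j∈)
    dx≡dy : dist a x ≡ dist a y
    dx≡dy = mid⇒dist-≡ a≡mid
    x≢a : x ≢ a
    x≢a x≡a = x≢y (trans x≡a (sym (dist≡0⇒≡ (trans (sym dx≡dy) (trans (cong (dist a) x≡a) (dist-self a))))))
    dx≢dz : dist a x ≢ dist a z
    dx≢dz dx≡dz = y≢z (mid-injectiveʳ (trans (sym a≡mid) (dist-≡⇒mid x≢z dx≡dz)))
    no-cover : z ≡ a → ∀ {i j} → i ∈ₗ indices n → j ∈ₗ indices n → i < j →
               ¬ (triple x y z ⊆ block n a i j)
    no-cover z≡a i∈ j∈ _ xyz⊆ =
      [ <⇒≢ (proj₁ (∈-indices⁻ i∈)) , <⇒≢ (proj₁ (∈-indices⁻ j∈)) ]′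
        (subst (Covers _ _) (trans (cong (dist a) z≡a) (dist-self a))
               (proj₂ (proj₂ (Equivalence.to (covers i∈ j∈) xyz⊆))))
    covers-exactly : ∀ {i j} → i ∈ₗ indices n → j ∈ₗ indices n → i < j →
                     triple x y z ⊆ block n a i j ⇔ (Covers i j (dist a x) × Covers i j (dist a z))
    covers-exactly i∈ j∈ _ = mk⇔
      (Product.map₂ proj₂ ∘ Equivalence.to (covers i∈ j∈))
      (λ (cx , cz) → Equivalence.from (covers i∈ j∈) (cx , subst (Covers _ _) dx≡dy cx , cz))
    by-cases : (z≟a : Dec (z ≡ a)) → occurrences (triple x y z) (Ba n a) ≡ 𝟙 (¬? z≟a)
    by-cases (yes z≡a) = count-pairs-≡0 (indices n) (block n a) (triple x y z ⊆?_) (no-cover z≡a)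
    by-cases (no  z≢a) = count-pairs-≡1 (indices n) (block n a) (triple x y z ⊆?_) indices-unique
      (∈-indices⁺ (dist-isRadius x≢a)) (∈-indices⁺ (dist-isRadius z≢a)) dx≢dz covers-exactly

  occurrences-Ba-no-apex : ∀ {a x y z} → x ≢ y → x ≢ z → y ≢ z →
                 a ≢ mid x y → a ≢ mid x z → a ≢ mid y z → occurrences (triple x y z) (Ba n a) ≡ 0
  occurrences-Ba-no-apex {a} {x} {y} {z} x≢y x≢z y≢z a≢xy a≢xz a≢yz =
    count-pairs-≡0 (indices n) (block n a) (triple x y z ⊆?_) no-cover
    where
    no-cover : ∀ {i j} → i ∈ₗ indices n → j ∈ₗ indices n → i < j → ¬ (triple x y z ⊆ block n a i j)
    no-cover i∈ j∈ _ xyz⊆ = ¬covers-three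
      (a≢xy ∘ dist-≡⇒mid x≢y) (a≢xz ∘ dist-≡⇒mid x≢z) (a≢yz ∘ dist-≡⇒mid y≢z)
      (Equivalence.to (triple⊆block⇔ (∈-indices⁻ i∈) (∈-indices⁻ j∈)) xyz⊆)

  apex : Fin n → Fin n → Fin n → ℕ
  apex c p a = 𝟙 (a ≟ᶠ c ×-dec ¬? (p ≟ᶠ a))

  occurrences-Ba-triple : ∀ {a x y z} → x ≢ y → x ≢ z → y ≢ z →
    occurrences (triple x y z) (Ba n a) ≡ apex (mid x y) z a + apex (mid x z) y a + apex (mid y z) x a
  occurrences-Ba-triple {a} {x} {y} {z} x≢y x≢z y≢z = by-cases (a ≟ᶠ mid x y) (a ≟ᶠ mid x z) (a ≟ᶠ mid y z)
    where
    by-cases : (a≟xy : Dec (a ≡ mid x y)) (a≟xz : Dec (a ≡ mid x z)) (a≟yz : Dec (a ≡ mid y z)) →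
      occurrences (triple x y z) (Ba n a) ≡ 𝟙 (a≟xy ×-dec ¬? (z ≟ᶠ a))
                                          + 𝟙 (a≟xz ×-dec ¬? (y ≟ᶠ a))
                                          + 𝟙 (a≟yz ×-dec ¬? (x ≟ᶠ a))
    by-cases (yes a≡xy) (yes a≡xz) _ = contradiction (mid-injectiveʳ (trans (sym a≡xy) a≡xz)) y≢z
    by-cases (yes a≡xy) (no _) (yes a≡yz) =
      contradiction (mid-injectiveʳ (trans (mid-comm y x) (trans (sym a≡xy) a≡yz))) x≢z
    by-cases (no _) (yes a≡xz) (yes a≡yz) =
      contradiction (mid-injectiveʳ (trans (mid-comm z x) (trans (sym a≡xz) (trans a≡yz (mid-comm y z))))) x≢y
    by-cases (yes a≡xy) (no _) (no _) =
      trans (occurrences-Ba-apex x≢y x≢z y≢z a≡xy) (sym (trans (+-identityʳ _) (+-identityʳ _)))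
    by-cases (no _) (yes a≡xz) (no _) = begin
      occurrences (triple x y z) (Ba n a)  ≡⟨ cong (λ T → occurrences T (Ba n a)) (triple-swap₂₃ x y z) ⟩
      occurrences (triple x z y) (Ba n a)  ≡⟨ occurrences-Ba-apex x≢z x≢y (y≢z ∘ sym) a≡xz ⟩
      𝟙 (¬? (y ≟ᶠ a))        ≡⟨ +-identityʳ _ ⟨
      𝟙 (¬? (y ≟ᶠ a)) + 0    ∎
      where open ≡-Reasoning
    by-cases (no _) (no _) (yes a≡yz) =
      trans (cong (λ T → occurrences T (Ba n a)) (triple-rotate x y z))
            (occurrences-Ba-apex y≢z (x≢y ∘ sym) (x≢z ∘ sym) a≡yz)
    by-cases (no a≢xy) (no a≢xz) (no a≢yz) = occurrences-Ba-no-apex x≢y x≢z y≢z a≢xy a≢xz a≢yz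

  ∑ : (Fin n → ℕ) → ℕ
  ∑ f = sum (map f (allFin n))

  ∑-apex : ∀ c p → ∑ (apex c p) ≡ 𝟙 (¬? (p ≟ᶠ c))
  ∑-apex c p = trans
    (sum-map-single _ (Unique.allFin⁺ n) (∈-allFin c) λ {a} _ a≢c → 𝟙-no (a ≟ᶠ c ×-dec ¬? (p ≟ᶠ a)) (a≢c ∘ proj₁))
    (𝟙-yes-×-dec (c ≟ᶠ c) refl (¬? (p ≟ᶠ c)))

  occurrences-triple : ∀ {x y z} → x ≢ y → x ≢ z → y ≢ z →
    occurrences (triple x y z) (allBlocks n)
      ≡ 𝟙 (¬? (z ≟ᶠ mid x y)) + 𝟙 (¬? (y ≟ᶠ mid x z)) + 𝟙 (¬? (x ≟ᶠ mid y z))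
  occurrences-triple {x} {y} {z} x≢y x≢z y≢z = begin
    occurrences (triple x y z) (allBlocks n)
      ≡⟨ length-filter-concatMap (triple x y z ⊆?_) (Ba n) (allFin n) ⟩
    ∑ (λ a → occurrences (triple x y z) (Ba n a))
      ≡⟨ cong sum (map-cong (λ a → occurrences-Ba-triple {a} x≢y x≢z y≢z) (allFin n)) ⟩
    ∑ (λ a → apex (mid x y) z a + apex (mid x z) y a + apex (mid y z) x a)
      ≡⟨ sum-map-+ (λ a → apex (mid x y) z a + apex (mid x z) y a) (apex (mid y z) x) (allFin n) ⟩
    ∑ (λ a → apex (mid x y) z a + apex (mid x z) y a) + ∑ (apex (mid y z) x)
      ≡⟨ cong (_+ ∑ (apex (mid y z) x)) (sum-map-+ (apex (mid x y) z) (apex (mid x z) y) (allFin n)) ⟩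
    ∑ (apex (mid x y) z) + ∑ (apex (mid x z) y) + ∑ (apex (mid y z) x)
      ≡⟨ cong₂ _+_ (cong₂ _+_ (∑-apex (mid x y) z) (∑-apex (mid x z) y)) (∑-apex (mid y z) x) ⟩
    𝟙 (¬? (z ≟ᶠ mid x y)) + 𝟙 (¬? (y ≟ᶠ mid x z)) + 𝟙 (¬? (x ≟ᶠ mid y z))
      ∎
    where open ≡-Reasoning

  ≡mid⇒ : ∀ {a x y} → a ≡ mid x y → toℕ a + toℕ a ≡ toℕ x + toℕ y mod n
  ≡mid⇒ refl = mid-spec _ _

  ≢mid : ∀ {a x y} → toℕ a + toℕ a < n → toℕ x + toℕ y < n →
         toℕ a + toℕ a ≢ toℕ x + toℕ y → a ≢ mid x y
  ≢mid a+a<n x+y<n a+a≢x+y = a+a≢x+y ∘ ≡-mod⇒≡ a+a<n x+y<n ∘ ≡mid⇒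

  occurrences-no-apex : ∀ {x y z} → x ≢ y → x ≢ z → y ≢ z →
    z ≢ mid x y → y ≢ mid x z → x ≢ mid y z → occurrences (triple x y z) (allBlocks n) ≡ 3
  occurrences-no-apex {x} {y} {z} x≢y x≢z y≢z z≢xy y≢xz x≢yz = trans (occurrences-triple x≢y x≢z y≢z)
    (cong₂ _+_ (cong₂ _+_ (𝟙-yes (¬? (z ≟ᶠ mid x y)) z≢xy) (𝟙-yes (¬? (y ≟ᶠ mid x z)) y≢xz))
               (𝟙-yes (¬? (x ≟ᶠ mid y z)) x≢yz))

  occurrences-middle-apex : ∀ {x y z} → x ≢ y → x ≢ z → y ≢ z →
    z ≢ mid x y → y ≡ mid x z → x ≢ mid y z → occurrences (triple x y z) (allBlocks n) ≡ 2
  occurrences-middle-apex {x} {y} {z} x≢y x≢z y≢z z≢xy y≡xz x≢yz = trans (occurrences-triple x≢y x≢z y≢z)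
    (cong₂ _+_ (cong₂ _+_ (𝟙-yes (¬? (z ≟ᶠ mid x y)) z≢xy)
                          (𝟙-no (¬? (y ≟ᶠ mid x z)) (λ y≢xz → y≢xz y≡xz)))
               (𝟙-yes (¬? (x ≟ᶠ mid y z)) x≢yz))

  ∣allBlocks∣≡4 : All (λ b → ∣ b ∣ ≡ 4) (allBlocks n)
  ∣allBlocks∣≡4 = AllP.concat⁺ (AllP.map⁺ (All.universal ∣Ba∣≡4 (allFin n)))

  module _ (3∤n : 3 ∤ n) where

    mid-mid : ∀ {x y z} → z ≡ mid x y → y ≡ mid x z → y ≡ z
    mid-mid {x} {y} {z} z≡xy y≡xz =
      toℕ-injective (≡-mod⇒≡ (toℕ<n y) (toℕ<n z) (*-cancelˡ-mod n⊥3 (begin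
        3 * toℕ y                    ≡⟨ thrice (toℕ y) ⟩
        toℕ y + toℕ y + toℕ y        ≈⟨ +-cong-mod (≡mid⇒ y≡xz) ≡-mod-refl ⟩
        toℕ x + toℕ z + toℕ y        ≡⟨ xy∙z≈xz∙y (toℕ x) (toℕ z) (toℕ y) ⟩
        toℕ x + toℕ y + toℕ z        ≈⟨ +-cong-mod (≡mid⇒ z≡xy) ≡-mod-refl ⟨
        toℕ z + toℕ z + toℕ z        ≡⟨ thrice (toℕ z) ⟨
        3 * toℕ z                    ∎)))
      where
      open ≡-mod-Reasoning
      n⊥3 : Coprime n 3
      n⊥3 = prime∤⇒coprime (from-yes (prime? 3)) 3∤n
      thrice : ∀ k → 3 * k ≡ k + k + k
      thrice k = trans (cong (λ u → k + (k + u)) (+-identityʳ k)) (sym (+-assoc k k k))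

    occurrences-triple-2⊎3 : ∀ {x y z} → x ≢ y → x ≢ z → y ≢ z →
      let o = occurrences (triple x y z) (allBlocks n) in o ≡ 2 ⊎ o ≡ 3
    occurrences-triple-2⊎3 {x} {y} {z} x≢y x≢z y≢z =
      Sum.map (trans eq) (trans eq) (by-cases (z ≟ᶠ mid x y) (y ≟ᶠ mid x z) (x ≟ᶠ mid y z))
      where
      eq : occurrences (triple x y z) (allBlocks n)
             ≡ 𝟙 (¬? (z ≟ᶠ mid x y)) + 𝟙 (¬? (y ≟ᶠ mid x z)) + 𝟙 (¬? (x ≟ᶠ mid y z))
      eq = occurrences-triple x≢y x≢z y≢z
      by-cases : (z≟xy : Dec (z ≡ mid x y)) (y≟xz : Dec (y ≡ mid x z)) (x≟yz : Dec (x ≡ mid y z)) →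
        let o = 𝟙 (¬? z≟xy) + 𝟙 (¬? y≟xz) + 𝟙 (¬? x≟yz) in o ≡ 2 ⊎ o ≡ 3
      by-cases (yes z≡xy) (yes y≡xz) _         = contradiction (mid-mid z≡xy y≡xz) y≢z
      by-cases (yes z≡xy) (no _)    (yes x≡yz) = contradiction (mid-mid (trans z≡xy (mid-comm x y)) x≡yz) x≢z
      by-cases (no _)    (yes y≡xz) (yes x≡yz) =
        contradiction (mid-mid (trans y≡xz (mid-comm x z)) (trans x≡yz (mid-comm y z))) x≢y
      by-cases (yes _) (no _)  (no _)  = inj₁ refl
      by-cases (no _)  (yes _) (no _)  = inj₁ refl
      by-cases (no _)  (no _)  (yes _) = inj₁ refl
      by-cases (no _)  (no _)  (no _)  = inj₂ refl

    occurrences-2⊎3 : ∀ (T : Subset n) → ∣ T ∣ ≡ 3 →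
      occurrences T (allBlocks n) ≡ 2 ⊎ occurrences T (allBlocks n) ≡ 3
    occurrences-2⊎3 T ∣T∣≡3 with x , y , z , x≢y , x≢z , y≢z , refl ← three-elements T ∣T∣≡3 =
      occurrences-triple-2⊎3 x≢y x≢z y≢z

odd⇒≡1+m+m : ∀ n → 2 ∤ n → ∃[ m ] n ≡ suc (m + m)
odd⇒≡1+m+m zero          2∤0   = contradiction (2 ∣0) 2∤0
odd⇒≡1+m+m (suc zero)    _     = 0 , refl
odd⇒≡1+m+m (suc (suc n)) 2∤2+n with m , refl ← odd⇒≡1+m+m n (2∤2+n ∘ ∣m∣n⇒∣m+n ∣-refl) =
  suc m , cong (2 +_) (sym (+-suc m m))

isAdesign : ∀ k → let n = suc (3 + k + (3 + k)) in 3 ∤ n → IsAdesign 3 n 4 2 (allBlocks n)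
isAdesign k 3∤n =
  ∣allBlocks∣≡4 ,
  occurrences-2⊎3 3∤n ,
  (triple (# 0) (# 1) (# 2) , ∣triple∣≡3 {n} (# 0) (# 1) (# 2) (λ ()) (λ ()) (λ ()) ,
   occurrences-middle-apex {# 0} {# 1} {# 2} (λ ()) (λ ()) (λ ())
     (≢mid (below7 4) (below7 1) (λ ())) (mid-unique ≡-mod-refl) (≢mid (below7 0) (below7 3) (λ ()))) ,
  (triple (# 0) (# 1) (# 3) , ∣triple∣≡3 {n} (# 0) (# 1) (# 3) (λ ()) (λ ()) (λ ()) ,
   occurrences-no-apex {# 0} {# 1} {# 3} (λ ()) (λ ()) (λ ())
     (≢mid (below7 6) (below7 1) (λ ())) (≢mid (below7 2) (below7 3) (λ ())) (≢mid (below7 0) (below7 4) (λ ())))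
  where
  open OddCycle (3 + k)
  -- For a literal i the implicit argument is solved by computation.
  below7 : ∀ i {_ : T (i <ᵇ 7)} → i < n
  below7 i {i<ᵇ7} = ≤-trans (<ᵇ⇒< i 7 i<ᵇ7) (s≤s (+-mono-≤ (m≤m+n 3 k) (m≤m+n 3 k)))

theorem12 : (n : ℕ) .{{_ : NonZero n}} → 7 ≤ n → ¬ (2 ∣ n) → ¬ (3 ∣ n) →
    IsAdesign 3 n 4 2 (allBlocks n)
theorem12 n 7≤n 2∤n 3∤n with odd⇒≡1+m+m n 2∤n
... | suc (suc (suc k)) , refl = isAdesign k 3∤n
... | 0 , refl = contradiction 7≤n λ { (s≤s ()) }
... | 1 , refl = contradiction 7≤n λ { (s≤s (s≤s (s≤s ()))) }
... | 2 , refl = contradiction 7≤n λ { (s≤s (s≤s (s≤s (s≤s (s≤s ()))))) }
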